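{- Let $n=3k-1$ with $k\geq 2$ an integer (so that $f_{n+1}$ is even), and let $S(n)=\langle f_n^2,f_{n+1}^2,f_{n+2}^2\rangle$. Then \[ \mathrm{Ap}(S(n),f_n^2) = \left\{ \lambda f_{n+1}^2 + \mu f_{n+2}^2 \mid (\lambda,\mu)\in (C_1 \times C_2) \setminus (C_3 \times C_4) \right\}, \] where $C_1=\{0,\dots,f_{n+2}-1\}$, $C_2=\{0,\dots,\frac{f_{n+1}}{2}-1\}$, $C_3=\{\frac{f_{n+1}}{2},\dots,f_{n+2}-1\}$, $C_4=\{\frac{f_{n-2}}{2},\dots,\frac{f_{n+1}}{2}-1\}$.
   Context: The Fibonacci numbers are defined by $f_0=0$, $f_1=1$, $f_k=f_{k-1}+f_{k-2}$ for $k\geq 2$. $\langle a_1,a_2,a_3\rangle$ denotes the set of all non-negative integer linear combinations of $a_1,a_2,a_3$; here it is a numerical semigroup (a submonoid of $(\mathbb{N},+)$ with finite complement). For a numerical semigroup $S$ and $m\in S\setminus\{0\}$, the Apéry set is $\mathrm{Ap}(S,m)=\{s\in S\mid s-m\notin S\}$. -}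

module Defs where

open import Data.Nat using (ℕ; zero; suc; _+_; _*_; _∸_; _≤_; _<_)
open import Data.Nat.DivMod using (_/_)
open import Data.Product using (∃; ∃-syntax; _×_; _,_)
open import Relation.Nullary using (¬_)
open import Relation.Binary.PropositionalEquality using (_≡_)

fib : ℕ → ℕ
fib zero = 0
fib (suc zero) = 1
fib (suc (suc k)) = fib (suc k) + fib k

InSG3 : ℕ → ℕ → ℕ → ℕ → Set
InSG3 a₁ a₂ a₃ s = ∃[ x ] ∃[ y ] ∃[ z ] s ≡ (x * a₁ + y * a₂ + z * a₃)

-- Apéry set of S with respect to m: s ∈ S and s - m ∉ S
-- (s - m ∉ S includes the case s < m, where s - m is negative and not in S ⊆ ℕ)
InApery3 : ℕ → ℕ → ℕ → ℕ → ℕ → Set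
InApery3 a₁ a₂ a₃ m s = InSG3 a₁ a₂ a₃ s × ¬ (m ≤ s × InSG3 a₁ a₂ a₃ (s ∸ m))

sq : ℕ → ℕ
sq x = x * x

{-# OPTIONS --safe #-}
module Submission where

-- Write a = f_n, b = f_{n+1}, c = f_{n+2}, g = f_{n-1} and f_{n-2} = 2e, so that a = g + 2e,
-- b = a + g = 2h with h = g + e, and c = b + a. The exchange relations
--   c b² = c a² + g c²,   h c² = h a² + (a + h) b²,   h b² + e c² = (a + 3h) a²
-- rewrite every y b² + z c² as u a² + l b² + m c² with (l, m) in the L-shape
-- {l < c, m < h} minus {l ≥ h, m ≥ e}. Conversely, Cassini's identity g b − a² = ±1 makes g²
-- an inverse of b² modulo a², from which the pairs (Y, Z) with Y b² + Z c² ≡ 0 (mod a²) are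
-- exactly the lattice spanned by (c, −g) and (h, e); the L-shape is a fundamental domain of
-- that lattice, so distinct points of it give elements incongruent modulo a². Hence an element
-- of S is in the Apéry set exactly when its normal form has u = 0.

open import Defs
open import Data.Product using (∃-syntax; _×_; _,_; proj₁; proj₂)
open import Data.Sum using (_⊎_; inj₁; inj₂)
open import Data.Empty using (⊥; ⊥-elim)
open import Data.List.Base using (_∷_; [])
open import Data.Integer.Base as ℤ using (ℤ; +_; -[1+_]; +[1+_]; +0; 0ℤ; 1ℤ; -1ℤ)
import Data.Integer.Properties as ℤ
open import Relation.Nullary using (¬_; yes; no)
open import Relation.Binary.PropositionalEquality
  using (_≡_; _≢_; refl; sym; trans; cong; cong₂; subst; subst₂; module ≡-Reasoning)
open import Function.Base using (id; _∘_)
open import Function.Bundles using (_⇔_; mk⇔)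
open import Function.Construct.Composition using (_⇔-∘_)

module CongruenceLattice where
  open import Data.Nat.Base as ℕ using (zero; suc)
  open import Data.Integer.Base using (_+_; _*_; _-_; -_; NonZero)
  open import Data.Integer.Tactic.RingSolver using (solve-∀; solve)
  open ≡-Reasoning

  Cassini : ℤ → ℤ → ℤ → Set
  Cassini x y z = x * z - y * y ≡ 1ℤ ⊎ x * z - y * y ≡ -1ℤ

  private
    cassini-defect-flips : ∀ x y → y * ((y + x) + y) - (y + x) * (y + x) ≡ - (x * (y + x) - y * y)
    cassini-defect-flips = solve-∀

  fib-cassini : ∀ m → Cassini (+ fib m) (+ fib (suc m)) (+ fib (suc (suc m)))
  fib-cassini zero = inj₂ refl
  fib-cassini (suc m) with fib-cassini m
  ... | inj₁ ε≡1  = inj₂ (trans (cassini-defect-flips (+ fib m) (+ fib (suc m))) (cong -_ ε≡1))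
  ... | inj₂ ε≡-1 = inj₁ (trans (cassini-defect-flips (+ fib m) (+ fib (suc m))) (cong -_ ε≡-1))

  i≡±1⇒i*i≡1 : ∀ {i} → i ≡ 1ℤ ⊎ i ≡ -1ℤ → i * i ≡ 1ℤ
  i≡±1⇒i*i≡1 (inj₁ refl) = refl
  i≡±1⇒i*i≡1 (inj₂ refl) = refl

  +m-+n≡+o⇒m≡n+o : ∀ m n {o} → + m - + n ≡ + o → m ≡ n ℕ.+ o
  +m-+n≡+o⇒m≡n+o m n {o} eq = ℤ.+-injective (begin
    + m               ≡⟨ add-back (+ m) (+ n) ⟩
    + n + (+ m - + n) ≡⟨ cong (_+_ (+ n)) eq ⟩
    + n + + o         ∎)
    where
    add-back : ∀ i j → i ≡ j + (i - j)
    add-back = solve-∀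

  +m-+n≡-+o⇒n≡m+o : ∀ m n {o} → + m - + n ≡ - + o → n ≡ m ℕ.+ o
  +m-+n≡-+o⇒n≡m+o m n {o} eq = +m-+n≡+o⇒m≡n+o n m (begin
    + n - + m     ≡⟨ swap-difference (+ m) (+ n) ⟩
    - (+ m - + n) ≡⟨ cong -_ eq ⟩
    - - + o       ≡⟨ ℤ.neg-involutive (+ o) ⟩
    + o           ∎)
    where
    swap-difference : ∀ i j → j - i ≡ - (i - j)
    swap-difference = solve-∀

  module Lattice (e g : ℤ) where
    -- INLINE lets the ring solver see these as polynomials in e and g.
    h a b c A B C ε : ℤ
    h = g + e
    {-# INLINE h #-}
    a = g + (e + e)
    {-# INLINE a #-}
    b = a + g
    {-# INLINE b #-}
    c = b + a
    {-# INLINE c #-}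
    A = a * a
    {-# INLINE A #-}
    B = b * b
    {-# INLINE B #-}
    C = c * c
    {-# INLINE C #-}
    ε = g * b - A
    {-# INLINE ε #-}

    data Coordinates (P Q Y Z : ℤ) : Set where
      coordinates : Y ≡ P * c + Q * h → Z ≡ Q * e - P * g → Coordinates P Q Y Z

    InLattice : ℤ → ℤ → Set
    InLattice Y Z = ∃[ P ] ∃[ Q ] Coordinates P Q Y Z

    Coordinates-swap : ∀ {P Q} x x' y y' → Coordinates P Q (x - x') (y - y') →
                       Coordinates (- P) (- Q) (x' - x) (y' - y)
    Coordinates-swap {P} {Q} x x' y y' (coordinates Y≡ Z≡) = coordinates Y'≡ Z'≡
      where
      Y'≡ : x' - x ≡ - P * c + - Q * h
      Y'≡ = begin
        x' - x            ≡⟨ solve (x ∷ x' ∷ []) ⟩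
        - (x - x')        ≡⟨ cong -_ Y≡ ⟩
        - (P * c + Q * h) ≡⟨ solve (P ∷ Q ∷ e ∷ g ∷ []) ⟩
        - P * c + - Q * h ∎
      Z'≡ : y' - y ≡ - Q * e - - P * g
      Z'≡ = begin
        y' - y            ≡⟨ solve (y ∷ y' ∷ []) ⟩
        - (y - y')        ≡⟨ cong -_ Z≡ ⟩
        - (Q * e - P * g) ≡⟨ solve (P ∷ Q ∷ e ∷ g ∷ []) ⟩
        - Q * e - - P * g ∎

    -- With K = 2gb − a² one has g²b² − a²K = ε², so when ε = ±1, g² inverts b² modulo a².
    -- The identities below turn this into a² ∣ eY − hZ and a² ∣ gY + cZ whenever
    -- Y b² + Z c² ≡ J a², with quotients P and Q.
    P Q : ℤ → ℤ → ℤ → ℤ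
    P Y Z J = g * g * (e * J - (a + + 3 * h) * Z) - (+ 2 * g * b - A) * (e * Y - h * Z)
    {-# INLINE P #-}
    Q Y Z J = g * g * (g * J + c * Z) - (+ 2 * g * b - A) * (g * Y + c * Z)
    {-# INLINE Q #-}

    P-identity : ∀ Y Z J →
                 ε * ε * (e * Y - h * Z) ≡ A * P Y Z J + e * g * g * (Y * B + Z * C - J * A)
    P-identity Y Z J = solve (e ∷ g ∷ Y ∷ Z ∷ J ∷ [])

    Q-identity : ∀ Y Z J →
                 ε * ε * (g * Y + c * Z) ≡ A * Q Y Z J + g * g * g * (Y * B + Z * C - J * A)
    Q-identity Y Z J = solve (e ∷ g ∷ Y ∷ Z ∷ J ∷ [])

    -- (eY − hZ, gY + cZ) is the adjugate of the basis matrix [c h; −g e] applied to (Y, Z),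
    -- and that matrix has determinant ce + gh = a².
    adjugate-Y : ∀ Y Z → A * Y ≡ (e * Y - h * Z) * c + (g * Y + c * Z) * h
    adjugate-Y Y Z = solve (e ∷ g ∷ Y ∷ Z ∷ [])

    adjugate-Z : ∀ Y Z → A * Z ≡ (g * Y + c * Z) * e - (e * Y - h * Z) * g
    adjugate-Z Y Z = solve (e ∷ g ∷ Y ∷ Z ∷ [])

    module _ (cassini : Cassini g a b) .{{_ : NonZero a}} where

      private
        instance
          A-nonZero : NonZero A
          A-nonZero = ℤ.i*j≢0 a a

      lattice : ∀ {l m l' m' J} → l * B + m * C ≡ J * A + (l' * B + m' * C) →
                InLattice (l - l') (m - m')
      lattice {l} {m} {l'} {m'} {J} congruent = P Y Z J , Q Y Z J , coordinates Y≡ Z≡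
        where
        Y Z : ℤ
        Y = l - l'
        Z = m - m'

        relation : Y * B + Z * C - J * A ≡ 0ℤ
        relation = trans (difference l m l' m' J) (ℤ.i≡j⇒i-j≡0 congruent)
          where
          difference : ∀ l m l' m' J → (l - l') * B + (m - m') * C - J * A
                                       ≡ l * B + m * C - (J * A + (l' * B + m' * C))
          difference l m l' m' J = solve (e ∷ g ∷ l ∷ m ∷ l' ∷ m' ∷ J ∷ [])

        divisible : ∀ {x} p k → ε * ε * x ≡ A * p + k * (Y * B + Z * C - J * A) → x ≡ A * p
        divisible {x} p k eq = begin
          x                                   ≡⟨ ℤ.*-identityˡ x ⟨
          1ℤ * x                              ≡⟨ cong (_* x) (i≡±1⇒i*i≡1 cassini) ⟨
          ε * ε * x                           ≡⟨ eq ⟩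
          A * p + k * (Y * B + Z * C - J * A) ≡⟨ cong (λ r → A * p + k * r) relation ⟩
          A * p + k * 0ℤ                      ≡⟨ cong (_+_ (A * p)) (ℤ.*-zeroʳ k) ⟩
          A * p + 0ℤ                          ≡⟨ ℤ.+-identityʳ (A * p) ⟩
          A * p                               ∎

        eY-hZ≡A*P : e * Y - h * Z ≡ A * P Y Z J
        eY-hZ≡A*P = divisible (P Y Z J) (e * g * g) (P-identity Y Z J)

        gY+cZ≡A*Q : g * Y + c * Z ≡ A * Q Y Z J
        gY+cZ≡A*Q = divisible (Q Y Z J) (g * g * g) (Q-identity Y Z J)

        factor⁺ : ∀ u v s t → (A * u) * s + (A * v) * t ≡ A * (u * s + v * t)
        factor⁺ u v s t = solve (e ∷ g ∷ u ∷ v ∷ s ∷ t ∷ [])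

        factor⁻ : ∀ u v s t → (A * u) * s - (A * v) * t ≡ A * (u * s - v * t)
        factor⁻ u v s t = solve (e ∷ g ∷ u ∷ v ∷ s ∷ t ∷ [])

        Y≡ : Y ≡ P Y Z J * c + Q Y Z J * h
        Y≡ = ℤ.*-cancelˡ-≡ A _ _ (begin
          A * Y                                     ≡⟨ adjugate-Y Y Z ⟩
          (e * Y - h * Z) * c + (g * Y + c * Z) * h ≡⟨ cong₂ (λ u v → u * c + v * h)
                                                             eY-hZ≡A*P gY+cZ≡A*Q ⟩
          (A * P Y Z J) * c + (A * Q Y Z J) * h     ≡⟨ factor⁺ _ _ c h ⟩
          A * (P Y Z J * c + Q Y Z J * h)           ∎)

        Z≡ : Z ≡ Q Y Z J * e - P Y Z J * g
        Z≡ = ℤ.*-cancelˡ-≡ A _ _ (begin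
          A * Z                                     ≡⟨ adjugate-Z Y Z ⟩
          (g * Y + c * Z) * e - (e * Y - h * Z) * g ≡⟨ cong₂ (λ u v → u * e - v * g)
                                                             gY+cZ≡A*Q eY-hZ≡A*P ⟩
          (A * Q Y Z J) * e - (A * P Y Z J) * g     ≡⟨ factor⁻ _ _ e g ⟩
          A * (Q Y Z J * e - P Y Z J * g)           ∎)

open CongruenceLattice

open import Data.Nat
  using (ℕ; zero; suc; _+_; _*_; _∸_; _≤_; _<_; z≤n; s≤s; z<s; _≤?_; >-nonZero)
open import Data.Nat.Properties
  using (≤-trans; m≤m+n; m≤n+m; +-mono-≤; m<n+m; *-mono-<; <⇒≢; <⇒≱; ≰⇒>;
         m≤n⇒∃[o]m+o≡n; m+[n∸m]≡n; m+n∸m≡n;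
         +-assoc; +-comm; +-identityʳ; *-comm; *-suc; *-distribʳ-+)
open import Data.Nat.DivMod using (_/_; m*n/n≡m; m/n*n≡m)
open import Data.Nat.Divisibility using (_∣_; _∣0; n∣m*n; ∣m∣n⇒∣m+n)
open import Data.Nat.Induction using (<-wellFounded)
open import Data.Nat.Tactic.RingSolver using (solve-∀; solve)
open import Induction.WellFounded using (Acc; acc)

fib-pos : ∀ m → 0 < fib (suc m)
fib-pos zero    = z<s
fib-pos (suc m) = ≤-trans (fib-pos m) (m≤m+n (fib (suc m)) (fib m))

2∣fib[k*3] : ∀ k → 2 ∣ fib (k * 3)
2∣fib[k*3] zero    = 2 ∣0
2∣fib[k*3] (suc k) = subst (2 ∣_) (regroup (fib (k * 3)) (fib (suc (k * 3))))
                       (∣m∣n⇒∣m+n (2∣fib[k*3] k) (n∣m*n (fib (suc (k * 3)))))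
  where
  regroup : ∀ u v → u + v * 2 ≡ (v + u) + v
  regroup = solve-∀

m+m≡m*2 : ∀ m → m + m ≡ m * 2
m+m≡m*2 = solve-∀

[m+m]/2≡m : ∀ m → (m + m) / 2 ≡ m
[m+m]/2≡m m = trans (cong (_/ 2) (m+m≡m*2 m)) (m*n/n≡m m 2)

module AperySetFromNormalForms (A B C : ℕ) (Region : ℕ → ℕ → Set) where
  open ≡-Reasoning

  NormalForm : ℕ → Set
  NormalForm s = ∃[ u ] ∃[ l ] ∃[ m ] Region l m × s ≡ u * A + (l * B + m * C)

  shift : ∀ k {s} → NormalForm s → NormalForm (k * A + s)
  shift k {s} (u , l , m , r , s≡) = k + u , l , m , r , (begin
    k * A + s                         ≡⟨ cong (_+_ (k * A)) s≡ ⟩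
    k * A + (u * A + (l * B + m * C)) ≡⟨ +-assoc (k * A) (u * A) _ ⟨
    k * A + u * A + (l * B + m * C)   ≡⟨ cong (_+ (l * B + m * C)) (*-distribʳ-+ A k u) ⟨
    (k + u) * A + (l * B + m * C)     ∎)

  apery-set : (∀ {s} → InSG3 A B C s → NormalForm s) →
              (∀ {t l m l' m'} → Region l m → Region l' m' →
                 l * B + m * C ≢ suc t * A + (l' * B + m' * C)) →
              ∀ s → InApery3 A B C A s ⇔ (∃[ l ] ∃[ m ] Region l m × s ≡ l * B + m * C)
  apery-set normal-form separated s = mk⇔ to from
    where
    to : InApery3 A B C A s → ∃[ l ] ∃[ m ] Region l m × s ≡ l * B + m * C
    to (s∈S , minimal) with normal-form s∈S
    ... | zero  , l , m , r , s≡ = l , m , r , s≡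
    ... | suc u , l , m , r , s≡ = ⊥-elim (minimal (A≤s , u , l , m , s∸A≡))
      where
      A≤s : A ≤ s
      A≤s = subst (A ≤_) (sym s≡) (≤-trans (m≤m+n A (u * A)) (m≤m+n _ _))
      s∸A≡ : s ∸ A ≡ u * A + l * B + m * C
      s∸A≡ = begin
        s ∸ A                             ≡⟨ cong (_∸ A) s≡ ⟩
        A + u * A + (l * B + m * C) ∸ A   ≡⟨ cong (_∸ A) (+-assoc A (u * A) _) ⟩
        A + (u * A + (l * B + m * C)) ∸ A ≡⟨ m+n∸m≡n A _ ⟩
        u * A + (l * B + m * C)           ≡⟨ +-assoc (u * A) _ _ ⟨
        u * A + l * B + m * C             ∎

    from : (∃[ l ] ∃[ m ] Region l m × s ≡ l * B + m * C) → InApery3 A B C A s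
    from (l , m , r , s≡) = (0 , l , m , s≡) , not-minimal
      where
      not-minimal : ¬ (A ≤ s × InSG3 A B C (s ∸ A))
      not-minimal (A≤s , s∸A∈S) with normal-form s∸A∈S
      ... | u , l' , m' , r' , s∸A≡ = separated {t = u} r r' (begin
        l * B + m * C                   ≡⟨ s≡ ⟨
        s                               ≡⟨ m+[n∸m]≡n A≤s ⟨
        A + (s ∸ A)                     ≡⟨ cong (_+_ A) s∸A≡ ⟩
        A + (u * A + (l' * B + m' * C)) ≡⟨ +-assoc A (u * A) _ ⟨
        suc u * A + (l' * B + m' * C)   ∎)

AperyIsLShaped : (a b c h e : ℕ) → Set
AperyIsLShaped a b c h e = ∀ s →
  InApery3 (sq a) (sq b) (sq c) (sq a) s
  ⇔ (∃[ l ] ∃[ m ] (l < c) × (m < h) × ¬ ((h ≤ l) × (e ≤ m)) × (s ≡ l * sq b + m * sq c))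

AperyIsLShaped-cong : ∀ {a b c h e a' b' c' h' e'} →
                      a ≡ a' → b ≡ b' → c ≡ c' → h ≡ h' → e ≡ e' →
                      AperyIsLShaped a b c h e → AperyIsLShaped a' b' c' h' e'
AperyIsLShaped-cong refl refl refl refl refl = id

module FibonacciSquares (e g : ℕ) where
  -- INLINE for the ring solver, as in CongruenceLattice.Lattice.
  h a b c A B C : ℕ
  h = g + e
  {-# INLINE h #-}
  a = g + (e + e)
  {-# INLINE a #-}
  b = a + g
  {-# INLINE b #-}
  c = b + a
  {-# INLINE c #-}
  A = a * a
  {-# INLINE A #-}
  B = b * b
  {-# INLINE B #-}
  C = c * c
  {-# INLINE C #-}

  LShape : ℕ → ℕ → Set
  LShape l m = l < c × m < h × ¬ (h ≤ l × e ≤ m)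

  open AperySetFromNormalForms A B C LShape
  open Lattice (+ e) (+ g) using (Coordinates; coordinates; InLattice; Coordinates-swap; lattice)

  exchange-l : ∀ y z → (c + y) * B + z * C ≡ c * A + (y * B + (g + z) * C)
  exchange-l y z = solve (e ∷ g ∷ y ∷ z ∷ [])

  exchange-m : ∀ y z → y * B + (h + z) * C ≡ h * A + ((a + h + y) * B + z * C)
  exchange-m y z = solve (e ∷ g ∷ y ∷ z ∷ [])

  exchange-corner : ∀ y z → (h + y) * B + (e + z) * C ≡ (a + 3 * h) * A + (y * B + z * C)
  exchange-corner y z = solve (e ∷ g ∷ y ∷ z ∷ [])

  beyond-c : ∀ {l m Z p q} l' → LShape l m →
             Coordinates +[1+ p ] (+ q) (+ l ℤ.- + l') Z → ⊥
  beyond-c {l = l} {p = p} {q = q} l' (l<c , _) (coordinates Y≡ _) = <⇒≱ l<c c≤l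
    where
    l≡ : l ≡ l' + (suc p * c + q * h)
    l≡ = +m-+n≡+o⇒m≡n+o l l'
           (trans Y≡ (sym (cong₂ ℤ._+_ (ℤ.pos-* (suc p) c) (ℤ.pos-* q h))))
    c≤l : c ≤ l
    c≤l = subst (c ≤_) (sym l≡)
            (≤-trans (≤-trans (m≤m+n c (p * c)) (m≤m+n _ (q * h))) (m≤n+m _ l'))

  beyond-h : ∀ {l' m' Y p q} m → LShape l' m' →
             Coordinates +[1+ p ] -[1+ q ] Y (+ m ℤ.- + m') → ⊥
  beyond-h {m' = m'} {p = p} {q = q} m (_ , m'<h , _) (coordinates _ Z≡) = <⇒≱ m'<h h≤m'
    where
    m'≡ : m' ≡ m + (suc q * e + suc p * g)
    m'≡ = +m-+n≡-+o⇒n≡m+o m m' (trans Z≡ (trans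
            (cong₂ ℤ._-_ (ℤ.-◃n≡-n (suc q * e)) (sym (ℤ.pos-* (suc p) g)))
            (sym (ℤ.neg-distrib-+ (+ (suc q * e)) (+ (suc p * g))))))
    h≤m' : h ≤ m'
    h≤m' = subst (h ≤_) (sym m'≡)
             (≤-trans (subst (_≤ suc q * e + suc p * g) (+-comm e g)
                        (+-mono-≤ (m≤m+n e (q * e)) (m≤m+n g (p * g))))
                      (m≤n+m _ m))

  in-corner : ∀ {l m q} l' m' → LShape l m →
              Coordinates +0 +[1+ q ] (+ l ℤ.- + l') (+ m ℤ.- + m') → ⊥
  in-corner {l} {m} {q} l' m' (_ , _ , outside-corner) (coordinates Y≡ Z≡) =
    outside-corner (h≤l , e≤m)
    where
    l≡ : l ≡ l' + suc q * h
    l≡ = +m-+n≡+o⇒m≡n+o l l' (trans Y≡ (trans (ℤ.+-identityˡ _) (sym (ℤ.pos-* (suc q) h))))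
    m≡ : m ≡ m' + suc q * e
    m≡ = +m-+n≡+o⇒m≡n+o m m' (trans Z≡ (trans (ℤ.+-identityʳ _) (sym (ℤ.pos-* (suc q) e))))
    h≤l : h ≤ l
    h≤l = subst (h ≤_) (sym l≡) (≤-trans (m≤m+n h (q * h)) (m≤n+m _ l'))
    e≤m : e ≤ m
    e≤m = subst (e ≤_) (sym m≡) (≤-trans (m≤m+n e (q * e)) (m≤n+m _ m'))

  -- Swapping the two points negates (P, Q), so (P, Q) may be taken 0 or lexicographically
  -- positive. P > 0, Q ≥ 0 forces l ≥ c; P > 0, Q < 0 forces m' ≥ h; P = 0, Q > 0 puts (l, m)
  -- in the removed corner.
  fundamental-domain : ∀ {l m l' m'} → LShape l m → LShape l' m' →
                       InLattice (+ l ℤ.- + l') (+ m ℤ.- + m') → l ≡ l' × m ≡ m'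
  fundamental-domain {l} {m} {l'} {m'} r r' (P , Q , coords) = classify P Q coords
    where
    flip : ∀ {P Q} → Coordinates P Q (+ l ℤ.- + l') (+ m ℤ.- + m') →
           Coordinates (ℤ.- P) (ℤ.- Q) (+ l' ℤ.- + l) (+ m' ℤ.- + m)
    flip = Coordinates-swap (+ l) (+ l') (+ m) (+ m')

    classify : ∀ P Q → Coordinates P Q (+ l ℤ.- + l') (+ m ℤ.- + m') → l ≡ l' × m ≡ m'
    classify +0        +0       (coordinates Y≡ Z≡) =
      trans (+m-+n≡+o⇒m≡n+o l l' Y≡) (+-identityʳ l') ,
      trans (+m-+n≡+o⇒m≡n+o m m' Z≡) (+-identityʳ m')
    classify +0        +[1+ _ ] coords = ⊥-elim (in-corner l' m' r coords)
    classify +0        -[1+ _ ] coords = ⊥-elim (in-corner l m r' (flip coords))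
    classify +[1+ _ ] (+ _)     coords = ⊥-elim (beyond-c l' r coords)
    classify +[1+ _ ] -[1+ _ ]  coords = ⊥-elim (beyond-h m r' coords)
    classify -[1+ _ ] +0        coords = ⊥-elim (beyond-c l r' (flip coords))
    classify -[1+ _ ] +[1+ _ ]  coords = ⊥-elim (beyond-h m' r (flip coords))
    classify -[1+ _ ] -[1+ _ ]  coords = ⊥-elim (beyond-c l r' (flip coords))

  module _ (0<g : 0 < g) where

    0<a : 0 < a
    0<a = ≤-trans 0<g (m≤m+n g (e + e))

    0<A : 0 < A
    0<A = *-mono-< 0<a 0<a

    reduction : ∀ y z → LShape y z ⊎
                        ∃[ k ] ∃[ y' ] ∃[ z' ] 0 < k × y * B + z * C ≡ k * A + (y' * B + z' * C)
    reduction y z with c ≤? y | h ≤? z | h ≤? y | e ≤? z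
    ... | yes c≤y | _ | _ | _ with m≤n⇒∃[o]m+o≡n c≤y
    ...   | y' , refl = inj₂ (c , y' , g + z , ≤-trans 0<a (m≤n+m a (a + g)) , exchange-l y' z)
    reduction y z | no _ | yes h≤z | _ | _ with m≤n⇒∃[o]m+o≡n h≤z
    ...   | z' , refl = inj₂ (h , a + h + y , z' , ≤-trans 0<g (m≤m+n g e) , exchange-m y z')
    reduction y z | no _ | no _ | yes h≤y | yes e≤z
      with m≤n⇒∃[o]m+o≡n h≤y | m≤n⇒∃[o]m+o≡n e≤z
    ...   | y' , refl | z' , refl =
      inj₂ (a + 3 * h , y' , z' , ≤-trans 0<a (m≤m+n a (3 * h)) , exchange-corner y' z')
    reduction y z | no c≰y | no h≰z | yes _  | no e≰z =
      inj₁ (≰⇒> c≰y , ≰⇒> h≰z , e≰z ∘ proj₂)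
    reduction y z | no c≰y | no h≰z | no h≰y | _ =
      inj₁ (≰⇒> c≰y , ≰⇒> h≰z , h≰y ∘ proj₁)

    reduce : ∀ y z → Acc _<_ (y * B + z * C) → NormalForm (y * B + z * C)
    reduce y z (acc smaller) with reduction y z
    ... | inj₁ shape = 0 , y , z , shape , refl
    ... | inj₂ (k , y' , z' , 0<k , yz≡) =
      subst NormalForm (sym yz≡) (shift k (reduce y' z' (smaller decreasing)))
      where
      decreasing : y' * B + z' * C < y * B + z * C
      decreasing = subst (y' * B + z' * C <_) (sym yz≡)
                     (m<n+m (y' * B + z' * C) (*-mono-< 0<k 0<A))

    normal-form : ∀ {s} → InSG3 A B C s → NormalForm s
    normal-form (x , y , z , refl) = subst NormalForm (sym (+-assoc (x * A) (y * B) (z * C)))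
                                       (shift x (reduce y z (<-wellFounded _)))

    module _ (cassini : Cassini (+ g) (+ a) (+ b)) where

      separated : ∀ {t l m l' m'} → LShape l m → LShape l' m' →
                  l * B + m * C ≢ suc t * A + (l' * B + m' * C)
      separated {t} {l} {m} {l'} {m'} r r' eq =
        <⇒≢ (m<n+m (l' * B + m' * C) (*-mono-< (s≤s (z≤n {t})) 0<A))
            (subst₂ (λ l m → l * B + m * C ≡ suc t * A + (l' * B + m' * C))
                    (proj₁ coincide) (proj₂ coincide) eq)
        where
        pos-*-square : ∀ x y → + (x * (y * y)) ≡ + x ℤ.* (+ y ℤ.* + y)
        pos-*-square x y = trans (ℤ.pos-* x (y * y)) (cong (+ x ℤ.*_) (ℤ.pos-* y y))

        congruent : + l ℤ.* (+ b ℤ.* + b) ℤ.+ + m ℤ.* (+ c ℤ.* + c)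
                    ≡ + suc t ℤ.* (+ a ℤ.* + a)
                      ℤ.+ (+ l' ℤ.* (+ b ℤ.* + b) ℤ.+ + m' ℤ.* (+ c ℤ.* + c))
        congruent = trans (sym (cong₂ ℤ._+_ (pos-*-square l b) (pos-*-square m c)))
                      (trans (cong +_ eq)
                        (cong₂ ℤ._+_ (pos-*-square (suc t) a)
                                     (cong₂ ℤ._+_ (pos-*-square l' b) (pos-*-square m' c))))

        coincide : l ≡ l' × m ≡ m'
        coincide = fundamental-domain r r'
                     (lattice cassini {{>-nonZero 0<a}} {+ l} {+ m} {+ l'} {+ m'} {+ suc t}
                              congruent)

      apery : AperyIsLShaped a b c h e
      apery s = reassociate ⇔-∘ apery-set normal-form (λ {t} → separated {t}) s
        where
        reassociate : (∃[ l ] ∃[ m ] LShape l m × s ≡ l * B + m * C) ⇔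
                      (∃[ l ] ∃[ m ] (l < c) × (m < h) × ¬ ((h ≤ l) × (e ≤ m))
                                     × (s ≡ l * B + m * C))
        reassociate =
          mk⇔ (λ (l , m , (l<c , m<h , outside) , s≡) → l , m , l<c , m<h , outside , s≡)
              (λ (l , m , l<c , m<h , outside , s≡) → l , m , (l<c , m<h , outside) , s≡)

fib-squares-apery : ∀ n → 2 ≤ n → 2 ∣ fib (n ∸ 2) →
  AperyIsLShaped (fib n) (fib (n + 1)) (fib (n + 2)) (fib (n + 1) / 2) (fib (n ∸ 2) / 2)
fib-squares-apery 0                ()       _
fib-squares-apery 1                (s≤s ()) _
fib-squares-apery n@(suc (suc T)) _        2∣f =
  AperyIsLShaped-cong a≡ b≡ c≡ h≡ refl (FibonacciSquares.apery e g (fib-pos T) cassini)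
  where
  g f e : ℕ
  g = fib (suc T)
  f = fib T
  e = f / 2

  f≡e+e : f ≡ e + e
  f≡e+e = trans (sym (m/n*n≡m 2∣f)) (sym (m+m≡m*2 e))

  cassini : Cassini (+ g) (+ (g + (e + e))) (+ (g + (e + e) + g))
  cassini = subst (λ x → Cassini (+ g) (+ (g + x)) (+ (g + x + g))) f≡e+e
                  (fib-cassini (suc T))

  a≡ : g + (e + e) ≡ fib n
  a≡ = cong (_+_ g) (sym f≡e+e)

  b≡ : g + (e + e) + g ≡ fib (n + 1)
  b≡ = trans (cong (_+ g) a≡) (cong fib (+-comm 1 n))

  c≡ : g + (e + e) + g + (g + (e + e)) ≡ fib (n + 2)
  c≡ = trans (cong₂ _+_ (cong (_+ g) a≡) a≡) (cong fib (+-comm 2 n))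

  h≡ : g + e ≡ fib (n + 1) / 2
  h≡ = trans (sym ([m+m]/2≡m (g + e))) (cong (_/ 2) (trans (regroup g e) b≡))
    where
    regroup : ∀ g e → (g + e) + (g + e) ≡ g + (e + e) + g
    regroup = solve-∀

3*[1+k]∸1≡2+k*3 : ∀ k → 3 * suc k ∸ 1 ≡ 2 + k * 3
3*[1+k]∸1≡2+k*3 k = cong (_∸ 1) (trans (*-suc 3 k) (cong (_+_ 3) (*-comm 3 k)))

proposition5p10 : (k n : ℕ) → 2 ≤ k → n ≡ 3 * k ∸ 1 → (s : ℕ) →
    InApery3 (sq (fib n)) (sq (fib (n + 1))) (sq (fib (n + 2))) (sq (fib n)) s
    ⇔ (∃[ l ] ∃[ m ] (l < fib (n + 2)) × (m < fib (n + 1) / 2)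
        × ¬ ((fib (n + 1) / 2 ≤ l) × (fib (n ∸ 2) / 2 ≤ m))
        × (s ≡ l * sq (fib (n + 1)) + m * sq (fib (n + 2))))
proposition5p10 zero    _ ()  _
proposition5p10 (suc k) n _   refl rewrite 3*[1+k]∸1≡2+k*3 k =
  fib-squares-apery (2 + k * 3) (s≤s (s≤s z≤n)) (2∣fib[k*3] k)
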